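{- For $n\in\{1,3\}$, every linear threshold function $f:\{ -1,1\}^n\to\{ -1,1\}$ satisfies $\mathrm{Stab}_\rho(f)\ge\mathrm{Stab}_\rho(\mathrm{Maj}_n)$ for all $\rho\in[0,1]$.
   Context: $\mathrm{sgn}(z)=1$ if $z\ge0$ and $-1$ if $z<0$. A function $f:\{ -1,1\}^n\to\{ -1,1\}$ is a linear threshold function if there are real constants $w_0,\dots,w_n$ with $f(\mathbf{x})=\mathrm{sgn}(w_0+w_1x_1+\cdots+w_nx_n)$ for all $\mathbf{x}$. For odd $n$, $\mathrm{Maj}_n(\mathbf{x})=\mathrm{sgn}(x_1+\cdots+x_n)$. For $\rho\in[0,1]$, $\mathrm{Stab}_\rho(f)=\mathbb{E}[f(\mathbf{x})f(\mathbf{y})]$ where $\mathbf{x}$ is uniform on $\{ -1,1\}^n$ and, independently for each $i$, $y_i=x_i$ with probability $\rho$ and $y_i=\pm1$ with probability $(1-\rho)/2$ each.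
   Formalization: The weights $w_0,\dots,w_n$ of each linear threshold function are rational rather than real, and the parameter ρ ranges over the rationals in [0,1]. -}

module Defs where

open import Data.Bool using (Bool; true; false; if_then_else_)
open import Data.Nat using (ℕ; zero; suc)
open import Data.Vec using (Vec; []; _∷_; zipWith)
open import Data.List using (List; []; _∷_; map; _++_; foldr)
open import Data.Product using (Σ; _×_)
open import Data.Rational using (ℚ; 0ℚ; 1ℚ; ½; _+_; _*_; _-_; -_; _≤_)
open import Data.Rational.Properties using (_≤?_)
open import Relation.Nullary using (does)
open import Relation.Binary.PropositionalEquality using (_≡_)

-- A point of {-1,1}^n is encoded as Vec Bool n, with true ↦ 1 and false ↦ -1.
val : Bool → ℚ
val true  = 1ℚ
val false = - 1ℚ

sumℚ : List ℚ → ℚ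
sumℚ = foldr _+_ 0ℚ

sumV : ∀ {n} → Vec ℚ n → ℚ
sumV []       = 0ℚ
sumV (x ∷ xs) = x + sumV xs

prodV : ∀ {n} → Vec ℚ n → ℚ
prodV []       = 1ℚ
prodV (x ∷ xs) = x * prodV xs

cube : (n : ℕ) → List (Vec Bool n)
cube zero    = [] ∷ []
cube (suc n) = map (true ∷_) (cube n) ++ map (false ∷_) (cube n)

sgn : ℚ → Bool
sgn z = does (0ℚ ≤? z)

IsLTF : ∀ {n} → (Vec Bool n → Bool) → Set
IsLTF {n} f = Σ ℚ λ w₀ → Σ (Vec ℚ n) λ w →
  ∀ (x : Vec Bool n) → f x ≡ sgn (w₀ + sumV (zipWith (λ wᵢ xᵢ → wᵢ * val xᵢ) w x))

Maj : ∀ {n} → Vec Bool n → Bool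
Maj x = sgn (sumV (Data.Vec.map val x))

-- Probability that y_i = b given x_i = a, under ρ-correlation:
-- y_i = x_i with probability ρ, otherwise uniform on {±1}.
trans : ℚ → Bool → Bool → ℚ
trans ρ true  true  = ρ + ½ * (1ℚ - ρ)
trans ρ false false = ρ + ½ * (1ℚ - ρ)
trans ρ true  false = ½ * (1ℚ - ρ)
trans ρ false true  = ½ * (1ℚ - ρ)

-- Probability of the pair (x, y): uniform x times the product of the
-- coordinate transition probabilities.
pairProb : ∀ {n} → ℚ → Vec Bool n → Vec Bool n → ℚ
pairProb ρ x y = prodV (zipWith (λ a b → ½ * trans ρ a b) x y)

Stab : ∀ {n} → ℚ → (Vec Bool n → Bool) → ℚ
Stab {n} ρ f =
  sumℚ (map (λ x → sumℚ (map (λ y → pairProb ρ x y * (val (f x) * val (f y))) (cube n))) (cube n))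

-- Writing σ = 1 − ρ, each factor ½ · trans ρ a b of pairProb is the linear form ½ρ + ¼σ or ¼σ
-- according as a = b or not, so Stab ρ f is a binary form Σⱼ cⱼ ρʲ σⁿ⁻ʲ (Bernstein coefficients)
-- whose value on ρ ∈ [0, 1] is monotone in the coefficients. A linear threshold function is unate
-- (monotone or antitone in every coordinate), and for n ∈ {1, 3} a finite computation over all
-- Boolean functions shows that every unate f has Bernstein coefficients at least those of Maj.
module Submission where

open import Data.Bool using (Bool; true; false; if_then_else_; b≤b) renaming (_≤_ to _≤ᵇ_)
open import Data.Bool.Properties using (≤-minimum) renaming (_≤?_ to _≤ᵇ?_)
open import Data.Fin using (Fin; zero; suc)
import Data.Fin.Properties as Fin
open import Data.List using (List; []; _∷_; map; foldr; cartesianProductWith)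
open import Data.List.Membership.Propositional using (_∈_)
open import Data.List.Membership.Propositional.Properties
  using (∈-map⁺; ∈-++⁺ˡ; ∈-++⁺ʳ; ∈-cartesianProductWith⁺)
open import Data.List.Properties using (map-cong)
open import Data.List.Relation.Unary.All as All using (All)
open import Data.List.Relation.Unary.Any using (here; there)
open import Data.Nat using (ℕ; zero; suc)
open import Data.Product using (∃-syntax; _×_; _,_)
open import Data.Rational
  using (ℚ; 0ℚ; 1ℚ; ½; _+_; _*_; _-_; -_; _≤_; nonNegative; nonPositive; +-*-rawSemiring)
open import Algebra.Definitions.RawSemiring +-*-rawSemiring using (_^_)
open import Data.Rational.Properties
  using ( _≤?_; ≤-refl; ≤-trans; ≤-total; ≤ᵇ⇒≤; module ≤-Reasoning
        ; +-identityˡ; +-inverseʳ; *-zeroʳ; *-comm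
        ; +-mono-≤; +-monoˡ-≤; +-monoʳ-≤; *-monoˡ-≤-nonNeg; *-monoʳ-≤-nonNeg; *-monoˡ-≤-nonPos)
open import Data.Rational.Solver using (module +-*-Solver)
open import Data.Sum using (_⊎_; inj₁; inj₂)
open import Data.Vec using (Vec; []; _∷_; zipWith; replicate; _∷ʳ_; lookup; _[_]≔_)
open import Data.Vec.Relation.Binary.Pointwise.Inductive as Pointwise using (Pointwise; []; _∷_)
open import Function using (_∘_; const)
open import Relation.Binary.PropositionalEquality as ≡
  using (_≡_; _≗_; refl; sym; cong; cong₂; subst; subst₂; module ≡-Reasoning)
open import Relation.Nullary using (Dec; does; yes; no; contradiction)
open import Relation.Nullary.Decidable using (map′; _⊎-dec_; _→-dec_; toWitness)
open import Relation.Unary using (Decidable)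

open import Defs
open +-*-Solver using (solve; _:=_; _:+_; _:*_; con)

_⊕_ : ∀ {m} → Vec ℚ m → Vec ℚ m → Vec ℚ m
_⊕_ = zipWith _+_

_•_ : ∀ {m} → ℚ → Vec ℚ m → Vec ℚ m
c • v = Data.Vec.map (c *_) v

infixl 6 _⊕_
infixr 7 _•_

sumF : ∀ {m} → List (Vec ℚ m) → Vec ℚ m
sumF = foldr _⊕_ (replicate _ 0ℚ)

-- ⟦ c₀ ∷ … ∷ cₖ ⟧ r s = Σⱼ cⱼ rʲ sᵏ⁻ʲ
⟦_⟧ : ∀ {m} → Vec ℚ m → ℚ → ℚ → ℚ
⟦ [] ⟧ r s = 0ℚ
⟦_⟧ {suc k} (c ∷ cs) r s = c * s ^ k + r * ⟦ cs ⟧ r s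

mulLinear : ∀ {m} → ℚ → ℚ → Vec ℚ m → Vec ℚ (suc m)
mulLinear a b v = a • (0ℚ ∷ v) ⊕ b • (v ∷ʳ 0ℚ)

module _ (r s : ℚ) where

  ⟦⟧-⊕ : ∀ {m} (u v : Vec ℚ m) → ⟦ u ⊕ v ⟧ r s ≡ ⟦ u ⟧ r s + ⟦ v ⟧ r s
  ⟦⟧-⊕ [] [] = sym (+-identityˡ 0ℚ)
  ⟦⟧-⊕ {suc k} (a ∷ u) (b ∷ v) rewrite ⟦⟧-⊕ u v =
    solve 6 (λ a b S r U V → (a :+ b) :* S :+ r :* (U :+ V) := (a :* S :+ r :* U) :+ (b :* S :+ r :* V))
      refl a b (s ^ k) r (⟦ u ⟧ r s) (⟦ v ⟧ r s)

  ⟦⟧-• : ∀ {m} c (v : Vec ℚ m) → ⟦ c • v ⟧ r s ≡ c * ⟦ v ⟧ r s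
  ⟦⟧-• c [] = sym (*-zeroʳ c)
  ⟦⟧-• {suc k} c (a ∷ v) rewrite ⟦⟧-• c v =
    solve 5 (λ c a S r V → c :* a :* S :+ r :* (c :* V) := c :* (a :* S :+ r :* V))
      refl c a (s ^ k) r (⟦ v ⟧ r s)

  ⟦⟧-replicate-0 : ∀ m → ⟦ replicate m 0ℚ ⟧ r s ≡ 0ℚ
  ⟦⟧-replicate-0 zero = refl
  ⟦⟧-replicate-0 (suc k) rewrite ⟦⟧-replicate-0 k =
    solve 2 (λ S r → con 0ℚ :* S :+ r :* con 0ℚ := con 0ℚ) refl (s ^ k) r

  ⟦⟧-sumF : ∀ {A : Set} {m} (F : A → Vec ℚ m) (xs : List A) →
            ⟦ sumF (map F xs) ⟧ r s ≡ sumℚ (map (λ x → ⟦ F x ⟧ r s) xs)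
  ⟦⟧-sumF {m = m} F [] = ⟦⟧-replicate-0 m
  ⟦⟧-sumF F (x ∷ xs) rewrite ⟦⟧-⊕ (F x) (sumF (map F xs)) | ⟦⟧-sumF F xs = refl

  ⟦⟧-0∷ : ∀ {m} (v : Vec ℚ m) → ⟦ 0ℚ ∷ v ⟧ r s ≡ r * ⟦ v ⟧ r s
  ⟦⟧-0∷ {m} v = solve 2 (λ S X → con 0ℚ :* S :+ X := X) refl (s ^ m) (r * ⟦ v ⟧ r s)

  ⟦⟧-∷ʳ0 : ∀ {m} (v : Vec ℚ m) → ⟦ v ∷ʳ 0ℚ ⟧ r s ≡ s * ⟦ v ⟧ r s
  ⟦⟧-∷ʳ0 [] = solve 2 (λ r s → con 0ℚ :* con 1ℚ :+ r :* con 0ℚ := s :* con 0ℚ) refl r s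
  ⟦⟧-∷ʳ0 {suc k} (c ∷ v) rewrite ⟦⟧-∷ʳ0 v =
    solve 5 (λ c s S r V → c :* (s :* S) :+ r :* (s :* V) := s :* (c :* S :+ r :* V))
      refl c s (s ^ k) r (⟦ v ⟧ r s)

  ⟦⟧-mulLinear : ∀ {m} a b (v : Vec ℚ m) → ⟦ mulLinear a b v ⟧ r s ≡ (a * r + b * s) * ⟦ v ⟧ r s
  ⟦⟧-mulLinear a b v = begin
    ⟦ a • (0ℚ ∷ v) ⊕ b • (v ∷ʳ 0ℚ) ⟧ r s
      ≡⟨ ⟦⟧-⊕ (a • (0ℚ ∷ v)) (b • (v ∷ʳ 0ℚ)) ⟩
    ⟦ a • (0ℚ ∷ v) ⟧ r s + ⟦ b • (v ∷ʳ 0ℚ) ⟧ r s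
      ≡⟨ cong₂ _+_ (⟦⟧-• a (0ℚ ∷ v)) (⟦⟧-• b (v ∷ʳ 0ℚ)) ⟩
    a * ⟦ 0ℚ ∷ v ⟧ r s + b * ⟦ v ∷ʳ 0ℚ ⟧ r s
      ≡⟨ cong₂ (λ x y → a * x + b * y) (⟦⟧-0∷ v) (⟦⟧-∷ʳ0 v) ⟩
    a * (r * ⟦ v ⟧ r s) + b * (s * ⟦ v ⟧ r s)
      ≡⟨ solve 5 (λ a b r s V → a :* (r :* V) :+ b :* (s :* V) := (a :* r :+ b :* s) :* V)
           refl a b r s (⟦ v ⟧ r s) ⟩
    (a * r + b * s) * ⟦ v ⟧ r s
      ∎
    where open ≡-Reasoning

0≤^ : ∀ {s} → 0ℚ ≤ s → ∀ k → 0ℚ ≤ s ^ k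
0≤^ 0≤s zero = ≤ᵇ⇒≤ _
0≤^ {s} 0≤s (suc k) = begin
  0ℚ          ≡⟨ sym (*-zeroʳ s) ⟩
  s * 0ℚ      ≤⟨ *-monoˡ-≤-nonNeg s {{nonNegative 0≤s}} (0≤^ 0≤s k) ⟩
  s * s ^ k   ∎
  where open ≤-Reasoning

⟦⟧-mono : ∀ {m} {u v : Vec ℚ m} {r s} → Pointwise _≤_ u v → 0ℚ ≤ r → 0ℚ ≤ s → ⟦ u ⟧ r s ≤ ⟦ v ⟧ r s
⟦⟧-mono [] 0≤r 0≤s = ≤-refl
⟦⟧-mono {suc k} {r = r} {s} (a≤b ∷ u≤v) 0≤r 0≤s =
  +-mono-≤ (*-monoʳ-≤-nonNeg (s ^ k) {{nonNegative (0≤^ 0≤s k)}} a≤b)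
           (*-monoˡ-≤-nonNeg r {{nonNegative 0≤r}} (⟦⟧-mono u≤v 0≤r 0≤s))

ρ-coefficient : Bool → Bool → ℚ
ρ-coefficient true  true  = ½
ρ-coefficient false false = ½
ρ-coefficient _     _     = 0ℚ

½*trans-agree : ∀ ρ σ → ½ * (ρ + ½ * σ) ≡ ½ * ρ + (½ * ½) * σ
½*trans-agree = solve 2 (λ ρ σ → con ½ :* (ρ :+ con ½ :* σ) := con ½ :* ρ :+ (con ½ :* con ½) :* σ) refl

½*trans-disagree : ∀ ρ σ → ½ * (½ * σ) ≡ 0ℚ * ρ + (½ * ½) * σ
½*trans-disagree = solve 2 (λ ρ σ → con ½ :* (con ½ :* σ) := con 0ℚ :* ρ :+ (con ½ :* con ½) :* σ) refl

½*trans≡linear : ∀ ρ a b → ½ * trans ρ a b ≡ ρ-coefficient a b * ρ + (½ * ½) * (1ℚ - ρ)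
½*trans≡linear ρ true  true  = ½*trans-agree ρ (1ℚ - ρ)
½*trans≡linear ρ false false = ½*trans-agree ρ (1ℚ - ρ)
½*trans≡linear ρ true  false = ½*trans-disagree ρ (1ℚ - ρ)
½*trans≡linear ρ false true  = ½*trans-disagree ρ (1ℚ - ρ)

pairForm : ∀ {n} → Vec Bool n → Vec Bool n → Vec ℚ (suc n)
pairForm []      []      = 1ℚ ∷ []
pairForm (a ∷ x) (b ∷ y) = mulLinear (ρ-coefficient a b) (½ * ½) (pairForm x y)

⟦pairForm⟧ : ∀ {n} ρ (x y : Vec Bool n) → ⟦ pairForm x y ⟧ ρ (1ℚ - ρ) ≡ pairProb ρ x y
⟦pairForm⟧ ρ [] [] = solve 1 (λ ρ → con 1ℚ :* con 1ℚ :+ ρ :* con 0ℚ := con 1ℚ) refl ρ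
⟦pairForm⟧ ρ (a ∷ x) (b ∷ y) = begin
  ⟦ mulLinear (ρ-coefficient a b) (½ * ½) (pairForm x y) ⟧ ρ (1ℚ - ρ)
    ≡⟨ ⟦⟧-mulLinear ρ (1ℚ - ρ) (ρ-coefficient a b) (½ * ½) (pairForm x y) ⟩
  (ρ-coefficient a b * ρ + (½ * ½) * (1ℚ - ρ)) * ⟦ pairForm x y ⟧ ρ (1ℚ - ρ)
    ≡⟨ cong₂ _*_ (sym (½*trans≡linear ρ a b)) (⟦pairForm⟧ ρ x y) ⟩
  ½ * trans ρ a b * pairProb ρ x y
    ∎
  where open ≡-Reasoning

stabForm : ∀ {n} → (Vec Bool n → Bool) → Vec ℚ (suc n)
stabForm {n} f =
  sumF (map (λ x → sumF (map (λ y → (val (f x) * val (f y)) • pairForm x y) (cube n))) (cube n))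

Stab≡⟦stabForm⟧ : ∀ {n} ρ (f : Vec Bool n → Bool) → Stab ρ f ≡ ⟦ stabForm f ⟧ ρ (1ℚ - ρ)
Stab≡⟦stabForm⟧ {n} ρ f = begin
  sumℚ (map (λ x → sumℚ (map (λ y → pairProb ρ x y * (val (f x) * val (f y))) (cube n))) (cube n))
    ≡⟨ cong sumℚ (map-cong (λ x → cong sumℚ (map-cong (term x) (cube n))) (cube n)) ⟩
  sumℚ (map (λ x → sumℚ (map (λ y → ⟦ weighted x y ⟧ ρ σ) (cube n))) (cube n))
    ≡⟨ cong sumℚ (map-cong (λ x → sym (⟦⟧-sumF ρ σ (weighted x) (cube n))) (cube n)) ⟩
  sumℚ (map (λ x → ⟦ sumF (map (weighted x) (cube n)) ⟧ ρ σ) (cube n))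
    ≡⟨ sym (⟦⟧-sumF ρ σ (λ x → sumF (map (weighted x) (cube n))) (cube n)) ⟩
  ⟦ stabForm f ⟧ ρ σ
    ∎
  where
  open ≡-Reasoning
  σ = 1ℚ - ρ
  weighted : Vec Bool n → Vec Bool n → Vec ℚ (suc n)
  weighted x y = (val (f x) * val (f y)) • pairForm x y
  term : ∀ x y → pairProb ρ x y * (val (f x) * val (f y)) ≡ ⟦ weighted x y ⟧ ρ σ
  term x y = begin
    pairProb ρ x y * (val (f x) * val (f y))       ≡⟨ *-comm (pairProb ρ x y) _ ⟩
    val (f x) * val (f y) * pairProb ρ x y         ≡⟨ cong (val (f x) * val (f y) *_) (⟦pairForm⟧ ρ x y) ⟨
    val (f x) * val (f y) * ⟦ pairForm x y ⟧ ρ σ   ≡⟨ ⟦⟧-• ρ σ (val (f x) * val (f y)) (pairForm x y) ⟨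
    ⟦ weighted x y ⟧ ρ σ                           ∎

p≤q⇒0≤q-p : ∀ {p q} → p ≤ q → 0ℚ ≤ q - p
p≤q⇒0≤q-p {p} {q} p≤q = begin
  0ℚ     ≡⟨ +-inverseʳ p ⟨
  p - p  ≤⟨ +-monoˡ-≤ (- p) p≤q ⟩
  q - p  ∎
  where open ≤-Reasoning

Stab-mono : ∀ {n} {f g : Vec Bool n → Bool} {ρ} → Pointwise _≤_ (stabForm f) (stabForm g) →
            0ℚ ≤ ρ → ρ ≤ 1ℚ → Stab ρ f ≤ Stab ρ g
Stab-mono {f = f} {g} {ρ} f≤g 0≤ρ ρ≤1 = begin
  Stab ρ f                  ≡⟨ Stab≡⟦stabForm⟧ ρ f ⟩
  ⟦ stabForm f ⟧ ρ (1ℚ - ρ) ≤⟨ ⟦⟧-mono f≤g 0≤ρ (p≤q⇒0≤q-p ρ≤1) ⟩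
  ⟦ stabForm g ⟧ ρ (1ℚ - ρ) ≡⟨ Stab≡⟦stabForm⟧ ρ g ⟨
  Stab ρ g                  ∎
  where open ≤-Reasoning

Stab-cong : ∀ {n} ρ {f g : Vec Bool n → Bool} → f ≗ g → Stab ρ f ≡ Stab ρ g
Stab-cong {n} ρ f≗g = cong sumℚ (map-cong (λ x → cong sumℚ (map-cong (λ y →
  cong₂ (λ u v → pairProb ρ x y * (val u * val v)) (f≗g x) (f≗g y)) (cube n))) (cube n))

MonotoneIn AntitoneIn : ∀ {n} → Fin n → (Vec Bool n → Bool) → Set
MonotoneIn i f = ∀ x → f (x [ i ]≔ false) ≤ᵇ f (x [ i ]≔ true)
AntitoneIn i f = ∀ x → f (x [ i ]≔ true) ≤ᵇ f (x [ i ]≔ false)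

Unate : ∀ {n} → (Vec Bool n → Bool) → Set
Unate f = ∀ i → MonotoneIn i f ⊎ AntitoneIn i f

∈-cube : ∀ {n} (x : Vec Bool n) → x ∈ cube n
∈-cube []                  = here refl
∈-cube (true ∷ x)          = ∈-++⁺ˡ (∈-map⁺ (true ∷_) (∈-cube x))
∈-cube {suc n} (false ∷ x) = ∈-++⁺ʳ (map (true ∷_) (cube n)) (∈-map⁺ (false ∷_) (∈-cube x))

∀-cube? : ∀ {n} {P : Vec Bool n → Set} → Decidable P → Dec (∀ x → P x)
∀-cube? {n} P? =
  map′ (λ all x → All.lookup all (∈-cube x)) (λ ∀P → All.tabulate (λ {x} _ → ∀P x)) (All.all? P? (cube n))

unate? : ∀ {n} (f : Vec Bool n → Bool) → Dec (Unate f)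
unate? f = Fin.all? λ i →
  ∀-cube? (λ x → f (x [ i ]≔ false) ≤ᵇ? f (x [ i ]≔ true)) ⊎-dec
  ∀-cube? (λ x → f (x [ i ]≔ true) ≤ᵇ? f (x [ i ]≔ false))

does-mono : ∀ {A B : Set} (a? : Dec A) (b? : Dec B) → (A → B) → does a? ≤ᵇ does b?
does-mono (yes a) (yes _) _   = b≤b
does-mono (yes a) (no ¬b) a→b = contradiction (a→b a) ¬b
does-mono (no _)  b?      _   = ≤-minimum (does b?)

sgn-mono : ∀ {z z′} → z ≤ z′ → sgn z ≤ᵇ sgn z′
sgn-mono {z} {z′} z≤z′ = does-mono (0ℚ ≤? z) (0ℚ ≤? z′) (λ 0≤z → ≤-trans 0≤z z≤z′)

sumV-zipWith-[]≔-mono : ∀ {n} (h : ℚ → Bool → ℚ) (w : Vec ℚ n) (x : Vec Bool n) i {b b′} →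
  h (lookup w i) b ≤ h (lookup w i) b′ →
  sumV (zipWith h w (x [ i ]≔ b)) ≤ sumV (zipWith h w (x [ i ]≔ b′))
sumV-zipWith-[]≔-mono h (wᵢ ∷ w) (xᵢ ∷ x) zero    le = +-monoˡ-≤ (sumV (zipWith h w x)) le
sumV-zipWith-[]≔-mono h (wᵢ ∷ w) (xᵢ ∷ x) (suc i) le = +-monoʳ-≤ (h wᵢ xᵢ) (sumV-zipWith-[]≔-mono h w x i le)

threshold-mono : ∀ {n} {f : Vec Bool n → Bool} w₀ w →
  (∀ x → f x ≡ sgn (w₀ + sumV (zipWith (λ wᵢ xᵢ → wᵢ * val xᵢ) w x))) →
  ∀ i x {b b′} → lookup w i * val b ≤ lookup w i * val b′ → f (x [ i ]≔ b) ≤ᵇ f (x [ i ]≔ b′)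
threshold-mono w₀ w f≡sgn i x le = subst₂ _≤ᵇ_ (sym (f≡sgn _)) (sym (f≡sgn _))
  (sgn-mono (+-monoʳ-≤ w₀ (sumV-zipWith-[]≔-mono (λ wᵢ xᵢ → wᵢ * val xᵢ) w x i le)))

val-false≤val-true : val false ≤ val true
val-false≤val-true = ≤ᵇ⇒≤ _

ltf⇒unate : ∀ {n} {f : Vec Bool n → Bool} → IsLTF f → Unate f
ltf⇒unate (w₀ , w , f≡sgn) i with ≤-total 0ℚ (lookup w i)
... | inj₁ 0≤wᵢ = inj₁ λ x → threshold-mono w₀ w f≡sgn i x (*-monoˡ-≤-nonNeg (lookup w i) {{nonNegative 0≤wᵢ}} val-false≤val-true)
... | inj₂ wᵢ≤0 = inj₂ λ x → threshold-mono w₀ w f≡sgn i x (*-monoˡ-≤-nonPos (lookup w i) {{nonPositive wᵢ≤0}} val-false≤val-true)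

IsLTF-resp : ∀ {n} {f g : Vec Bool n → Bool} → f ≗ g → IsLTF f → IsLTF g
IsLTF-resp f≗g (w₀ , w , f≡sgn) = w₀ , w , λ x → ≡.trans (sym (f≗g x)) (f≡sgn x)

branch : ∀ {n} → (Vec Bool n → Bool) → (Vec Bool n → Bool) → Vec Bool (suc n) → Bool
branch g h (b ∷ x) = if b then g x else h x

booleanFunctions : (n : ℕ) → List (Vec Bool n → Bool)
booleanFunctions zero    = const true ∷ const false ∷ []
booleanFunctions (suc n) = cartesianProductWith branch (booleanFunctions n) (booleanFunctions n)

booleanFunctions-complete : ∀ {n} (f : Vec Bool n → Bool) → ∃[ g ] g ∈ booleanFunctions n × f ≗ g
booleanFunctions-complete {zero} f with f [] in f[]≡b
... | true  = const true  , here refl         , λ { [] → f[]≡b }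
... | false = const false , there (here refl) , λ { [] → f[]≡b }
booleanFunctions-complete {suc n} f =
  let g , g∈ , f≗g = booleanFunctions-complete (f ∘ (true ∷_))
      h , h∈ , f≗h = booleanFunctions-complete (f ∘ (false ∷_))
  in branch g h , ∈-cartesianProductWith⁺ branch g∈ h∈ , λ { (true ∷ x) → f≗g x ; (false ∷ x) → f≗h x }

MajorityCertificate : ℕ → Set
MajorityCertificate n =
  All (λ g → Unate g → Pointwise _≤_ (stabForm (Maj {n})) (stabForm g)) (booleanFunctions n)

majorityCertificate? : ∀ n → Dec (MajorityCertificate n)
majorityCertificate? n =
  All.all? (λ g → unate? g →-dec Pointwise.decidable _≤?_ (stabForm Maj) (stabForm g)) (booleanFunctions n)

Stab-Maj≤Stab-LTF : ∀ {n} → MajorityCertificate n → (f : Vec Bool n → Bool) → IsLTF f →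
                    ∀ ρ → 0ℚ ≤ ρ → ρ ≤ 1ℚ → Stab ρ (Maj {n}) ≤ Stab ρ f
Stab-Maj≤Stab-LTF {n} certificate f ltf ρ 0≤ρ ρ≤1 =
  let g , g∈ , f≗g = booleanFunctions-complete f
      Maj≤g = All.lookup certificate g∈ (ltf⇒unate (IsLTF-resp f≗g ltf))
  in subst (Stab ρ (Maj {n}) ≤_) (sym (Stab-cong ρ f≗g)) (Stab-mono {f = Maj} {g} Maj≤g 0≤ρ ρ≤1)

lemma5 : (n : ℕ) → (n ≡ 1 ⊎ n ≡ 3) →
         (f : Vec Bool n → Bool) → IsLTF f →
         (ρ : ℚ) → 0ℚ ≤ ρ → ρ ≤ 1ℚ →
         Stab ρ (Maj {n}) ≤ Stab ρ f
lemma5 _ (inj₁ refl) = Stab-Maj≤Stab-LTF (toWitness {a? = majorityCertificate? 1} _)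
lemma5 _ (inj₂ refl) = Stab-Maj≤Stab-LTF (toWitness {a? = majorityCertificate? 3} _)
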